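{- Let $D$ be a finite source-free bipartite digraph with bipartition $U\cup V$. If $q\ge 3$ is an odd integer and every directed cycle of $D$ has length at least $(q+3)/2$, then $D$ contains a $q$-kernel $Q$ with $|Q|\le\frac{2}{q+3}|V(D)|$ and $Q\subseteq U$.
   Context: A digraph is source-free if every vertex has in-degree at least $1$. A partition $U,V$ of $V(D)$ is a bipartition if every arc has exactly one endpoint in $U$ and one in $V$. A set is independent if there are no arcs between two of its vertices. $\mathrm{dist}(S,v)$ is the minimum over $u\in S$ of the length of a shortest directed path from $u$ to $v$. A $q$-kernel is an independent set $Q$ with $\mathrm{dist}(Q,v)\le q$ for all $v\in V(D)$. -}

module Defs where

open import Data.Nat using (ℕ; zero; suc; _+_; _*_; _≤_; _<_)
open import Data.Fin using (Fin)
open import Data.Fin.Subset using (Subset; _∈_; _∉_; ∣_∣; _⊆_)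
open import Data.Bool using (Bool; T)
open import Data.Product using (Σ; ∃; _×_; _,_)
open import Data.Sum using (_⊎_)
open import Data.Vec using (Vec; lookup; head; last)
open import Data.Vec.Relation.Unary.AllPairs using (AllPairs)
open import Data.Vec.Relation.Unary.Linked using (Linked)
open import Relation.Binary.PropositionalEquality using (_≡_; _≢_)
open import Relation.Nullary using (¬_)

record Digraph : Set where
  field
    n   : ℕ
    adj : Fin n → Fin n → Bool

open Digraph public

Vtx : Digraph → Set
Vtx D = Fin (n D)

Arc : (D : Digraph) → Vtx D → Vtx D → Set
Arc D u v = T (adj D u v)

SourceFree : Digraph → Set
SourceFree D = ∀ (v : Vtx D) → ∃ λ (u : Vtx D) → Arc D u v

IsBipartition : (D : Digraph) → Subset (n D) → Set
IsBipartition D U = ∀ (u v : Vtx D) → Arc D u v →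
  (u ∈ U × v ∉ U) ⊎ (u ∉ U × v ∈ U)

Independent : (D : Digraph) → Subset (n D) → Set
Independent D S = ∀ (u v : Vtx D) → u ∈ S → v ∈ S → ¬ Arc D u v

data Walk (D : Digraph) : Vtx D → Vtx D → ℕ → Set where
  [] : ∀ {u} → Walk D u u 0
  _∷_ : ∀ {u w v k} → Arc D u w → Walk D w v k → Walk D u v (suc k)

-- dist(S, v) ≤ q : some directed path of length ≤ q from a vertex of S to v
-- (a shortest path exists iff a walk exists; length of a shortest walk = dist).
DistLe : (D : Digraph) → Subset (n D) → Vtx D → ℕ → Set
DistLe D S v q = ∃ λ (u : Vtx D) → ∃ λ (k : ℕ) → u ∈ S × k ≤ q × Walk D u v k

IsQKernel : (D : Digraph) → ℕ → Subset (n D) → Set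
IsQKernel D q Q = Independent D Q × (∀ (v : Vtx D) → DistLe D Q v q)

IsDirectedCycle : (D : Digraph) → (ℓ : ℕ) → Vec (Vtx D) (suc ℓ) → Set
IsDirectedCycle D ℓ xs =
  AllPairs _≢_ xs × Linked (Arc D) xs × Arc D (last xs) (head xs)

{-# OPTIONS --safe #-}
-- Fix an in-neighbour p v of every vertex v. As p^t v, …, p v, v is a walk, it suffices to find
-- Q ⊆ U meeting every sequence v, p v, …, p^q v, where q = 2k + 1. The functional graph of p
-- consists of cycles, all of length ≥ k + 2, with trees hanging from them. In each component
-- pick ρ ∈ U on the cycle and view the component as a tree rooted at ρ by forgetting the arc
-- from p ρ to ρ; call a vertex alive if its path to ρ avoids Q. While some alive vertex has
-- depth ≥ q, take a deepest one, v, and add to Q the vertex a = p^r v ∈ U with r ∈ {2k, 2k + 1}: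
-- everything this kills lies below a at depth ≤ depth v, hence is covered, and the path from v
-- to a alone kills 2k + 1 ≥ k + 2 alive vertices. Finally, if some alive vertex is still
-- uncovered, add ρ. It is paid for by the cycle if that is still alive, and otherwise by the
-- surplus of the step that cut the cycle together with the alive path from such a vertex to ρ.

module Submission where

open import Defs
open import Data.Nat using (ℕ; suc; _+_; _*_; _≤_)
open import Relation.Binary.PropositionalEquality using (_≡_)
open import Data.Fin.Subset using (Subset; _⊆_; ∣_∣)
open import Data.Vec using (Vec)
open import Data.Product using (∃; _×_)

open import Data.Fin using (Fin; toℕ)
open import Data.Fin.Properties using (_≟_; pigeonhole; any?)
open import Data.Fin.Subset using (_∈_; _∉_; _∪_; _─_; _-_; ⁅_⁆; inside; outside; ⊤; Nonempty)
  renaming (⊥ to ∅)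
open import Data.Fin.Subset.Properties
open import Data.List using (filter; allFin)
open import Data.List.Extrema.Nat using (argmax; argmax-all; f[xs]≤f[argmax])
open import Data.List.Membership.Propositional.Properties using (∈-filter⁺; ∈-allFin)
open import Data.List.Relation.Unary.All using (lookup)
open import Data.List.Relation.Unary.All.Properties using (all-filter)
open import Data.Nat using (zero; _<_; _∸_; z≤n; s≤s; _≤?_; _<?_)
open import Data.Nat.GeneralisedArithmetic using (fold; fold-+)
open import Data.Nat.Induction using (<-wellFounded)
open import Data.Nat.Properties hiding (_≟_)
open import Data.Nat.Tactic.RingSolver using (solve-∀)
open import Data.Product using (∃₂; _,_; proj₁; proj₂)
open import Data.Sum using (_⊎_; inj₁; inj₂; [_,_])
open import Data.Vec using (_∷_; []; head; last; tabulate; here; there)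
open import Data.Vec.Properties using (lookup∘tabulate; lookup⇒[]=; []=⇒lookup)
open import Data.Vec.Relation.Unary.All using (All; []; _∷_)
open import Data.Vec.Relation.Unary.AllPairs using (AllPairs; []; _∷_)
open import Data.Vec.Relation.Unary.Linked using (Linked; [-]; _∷_)
open import Function using (_∘_)
open import Induction.WellFounded using (Acc; acc)
open import Level using (Level)
open import Relation.Binary.Definitions using (tri<; tri≈; tri>)
open import Relation.Binary.PropositionalEquality
  using (_≢_; refl; sym; trans; cong; subst; subst₂; module ≡-Reasoning)
open import Relation.Nullary using (¬_; yes; no; does; contradiction)
open import Relation.Nullary.Decidable using (dec-true; map′; _×-dec_; ¬?; decidable-stable)
open import Relation.Unary using (Pred; Decidable)

private
  variable
    ℓ : Level

InjectiveUpTo : ∀ {A : Set ℓ} → (ℕ → A) → ℕ → Set ℓ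
InjectiveUpTo f r = ∀ {i j} → i ≤ r → j ≤ r → f i ≡ f j → i ≡ j

module _ {n} {P : Pred (Fin n) ℓ} (P? : Decidable P) where

  ⟦_⟧ : Subset n
  ⟦_⟧ = tabulate (does ∘ P?)

  ∈⟦⟧⁺ : ∀ {x} → P x → x ∈ ⟦_⟧
  ∈⟦⟧⁺ {x} px = lookup⇒[]= x ⟦_⟧ (trans (lookup∘tabulate (does ∘ P?) x) (dec-true (P? x) px))

  ∈⟦⟧⁻ : ∀ {x} → x ∈ ⟦_⟧ → P x
  ∈⟦⟧⁻ {x} x∈ with P? x | trans (sym (lookup∘tabulate (does ∘ P?) x)) ([]=⇒lookup x∈)
  ... | yes px | _ = px
  ... | no _   | ()

p⊆r∧q⊆r⇒p∪q⊆r : ∀ {n} {p q r : Subset n} → p ⊆ r → q ⊆ r → p ∪ q ⊆ r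
p⊆r∧q⊆r⇒p∪q⊆r {p = p} {q} p⊆r q⊆r x∈p∪q = [ p⊆r , q⊆r ] (x∈p∪q⁻ p q x∈p∪q)

x∈p⇒⁅x⁆⊆p : ∀ {n} {x : Fin n} {p} → x ∈ p → ⁅ x ⁆ ⊆ p
x∈p⇒⁅x⁆⊆p {x = x} x∈p y∈⁅x⁆ = subst (_∈ _) (sym (x∈⁅y⁆⇒x≡y x y∈⁅x⁆)) x∈p

x∈p─q⇒x∉q : ∀ {n} {x : Fin n} (p q : Subset n) → x ∈ p ─ q → x ∉ q
x∈p─q⇒x∉q (_ ∷ p) (outside ∷ q) here       ()
x∈p─q⇒x∉q (_ ∷ p) (_       ∷ q) (there x∈) (there x∈q) = x∈p─q⇒x∉q p q x∈ x∈q

∣p∪q∣≤∣p∣+∣q∣ : ∀ {n} (p q : Subset n) → ∣ p ∪ q ∣ ≤ ∣ p ∣ + ∣ q ∣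
∣p∪q∣≤∣p∣+∣q∣ []            []            = z≤n
∣p∪q∣≤∣p∣+∣q∣ (outside ∷ p) (outside ∷ q) = ∣p∪q∣≤∣p∣+∣q∣ p q
∣p∪q∣≤∣p∣+∣q∣ (outside ∷ p) (inside  ∷ q) =
  ≤-trans (s≤s (∣p∪q∣≤∣p∣+∣q∣ p q)) (≤-reflexive (sym (+-suc _ _)))
∣p∪q∣≤∣p∣+∣q∣ (inside  ∷ p) (outside ∷ q) = s≤s (∣p∪q∣≤∣p∣+∣q∣ p q)
∣p∪q∣≤∣p∣+∣q∣ (inside  ∷ p) (inside  ∷ q) =
  s≤s (≤-trans (∣p∪q∣≤∣p∣+∣q∣ p q) (+-monoʳ-≤ ∣ p ∣ (n≤1+n _)))

∣p∪⁅x⁆∣≤1+∣p∣ : ∀ {n} (p : Subset n) x → ∣ p ∪ ⁅ x ⁆ ∣ ≤ suc ∣ p ∣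
∣p∪⁅x⁆∣≤1+∣p∣ p x =
  ≤-trans (∣p∪q∣≤∣p∣+∣q∣ p ⁅ x ⁆) (≤-reflexive (trans (cong (∣ p ∣ +_) (∣⁅x⁆∣≡1 x)) (+-comm ∣ p ∣ 1)))

q⊆p⇒∣p∣≡∣q∣+∣p─q∣ : ∀ {n} {p q : Subset n} → q ⊆ p → ∣ p ∣ ≡ ∣ q ∣ + ∣ p ─ q ∣
q⊆p⇒∣p∣≡∣q∣+∣p─q∣ {p = []}          {[]}          _   = refl
q⊆p⇒∣p∣≡∣q∣+∣p─q∣ {p = outside ∷ p} {outside ∷ q} q⊆p =
  q⊆p⇒∣p∣≡∣q∣+∣p─q∣ (drop-∷-⊆ q⊆p)
q⊆p⇒∣p∣≡∣q∣+∣p─q∣ {p = outside ∷ p} {inside  ∷ q} q⊆p = contradiction (q⊆p here) λ ()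
q⊆p⇒∣p∣≡∣q∣+∣p─q∣ {p = inside  ∷ p} {outside ∷ q} q⊆p =
  trans (cong suc (q⊆p⇒∣p∣≡∣q∣+∣p─q∣ (drop-∷-⊆ q⊆p))) (sym (+-suc _ _))
q⊆p⇒∣p∣≡∣q∣+∣p─q∣ {p = inside  ∷ p} {inside  ∷ q} q⊆p =
  cong suc (q⊆p⇒∣p∣≡∣q∣+∣p─q∣ (drop-∷-⊆ q⊆p))

injective⇒≤∣p∣ : ∀ {n} {p : Subset n} (f : ℕ → Fin n) r →
  InjectiveUpTo f r → (∀ {i} → i ≤ r → f i ∈ p) → suc r ≤ ∣ p ∣
injective⇒≤∣p∣ f zero    _   f∈p = ≤-trans (s≤s z≤n) (x∈p⇒∣p-x∣<∣p∣ (f∈p z≤n))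
injective⇒≤∣p∣ {p = p} f (suc r) inj f∈p = ≤-trans (s≤s rest) (x∈p⇒∣p-x∣<∣p∣ (f∈p ≤-refl))
  where
  rest : suc r ≤ ∣ p - f (suc r) ∣
  rest = injective⇒≤∣p∣ f r (λ i≤r j≤r → inj (m≤n⇒m≤1+n i≤r) (m≤n⇒m≤1+n j≤r))
    (λ i≤r → x∈p∧x≢y⇒x∈p-y (f∈p (m≤n⇒m≤1+n i≤r))
                            (<⇒≢ (s≤s i≤r) ∘ inj (m≤n⇒m≤1+n i≤r) ≤-refl))

Least : Pred ℕ ℓ → ℕ → Set ℓ
Least P m = P m × (∀ {s} → s < m → ¬ P s)

Least⇒≤ : ∀ {P : Pred ℕ ℓ} {m t} → Least P m → P t → m ≤ t
Least⇒≤ (_ , below) pt = ≮⇒≥ (λ t<m → below t<m pt)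

-- The least i < b with P i, and b if there is none.
least : {P : Pred ℕ ℓ} → Decidable P → ℕ → ℕ
least P? zero    = zero
least P? (suc b) with P? zero
... | yes _ = zero
... | no  _ = suc (least (P? ∘ suc) b)

least-Least : ∀ {P : Pred ℕ ℓ} (P? : Decidable P) {b t} → t < b → P t → Least P (least P? b)
least-Least P? {suc b} {t} t<b pt with P? zero
... | yes p0 = p0 , λ ()
least-Least P? {suc b} {zero}  _         pt | no ¬p0 = contradiction pt ¬p0
least-Least P? {suc b} {suc t} (s≤s t<b) pt | no ¬p0 with least-Least (P? ∘ suc) t<b pt
... | pm , below = pm , λ { {zero} _ → ¬p0 ; {suc s} (s≤s s<m) → below s<m }

maximiser : ∀ {n} {P : Pred (Fin n) ℓ} → Decidable P → (f : Fin n → ℕ) →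
  ∃ P → ∃ λ m → P m × (∀ {y} → P y → f y ≤ f m)
maximiser {n = n} P? f (x , px) =
  argmax f x ys , argmax-all f px (all-filter P? (allFin n)) ,
  λ {y} py → lookup (f[xs]≤f[argmax] x ys) (∈-filter⁺ P? (∈-allFin y) py)
  where
  ys = filter P? (allFin n)

m∸j+i<m : ∀ {i j m} → i < j → j ≤ m → m ∸ j + i < m
m∸j+i<m {i} {j} {m} i<j j≤m = <-≤-trans (+-monoʳ-< (m ∸ j) i<j) (≤-reflexive (m∸n+n≡m j≤m))

2*[k+2]≡[1+2k]+3 : ∀ k → 2 * (k + 2) ≡ suc (2 * k) + 3
2*[k+2]≡[1+2k]+3 = solve-∀

charge-absorbed : ∀ {x y c K} → x + c ≤ K + y → K ≤ c → x ≤ y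
charge-absorbed {x} {y} {c} {K} x+c≤K+y K≤c = +-cancelʳ-≤ K x y (begin
  x + K ≤⟨ +-monoʳ-≤ x K≤c ⟩
  x + c ≤⟨ x+c≤K+y ⟩
  K + y ≡⟨ +-comm K y ⟩
  y + K ∎)
  where open ≤-Reasoning

charge-doubled : ∀ {x y c K M} → x + c ≤ K + y → K + K ≤ c + M → K + x ≤ y + M
charge-doubled {x} {y} {c} {K} {M} x+c≤K+y 2K≤c+M = +-cancelʳ-≤ K (K + x) (y + M) (begin
  (K + x) + K   ≡⟨ cong (_+ K) (+-comm K x) ⟩
  (x + K) + K   ≡⟨ +-assoc x K K ⟩
  x + (K + K)   ≤⟨ +-monoʳ-≤ x 2K≤c+M ⟩
  x + (c + M)   ≡⟨ +-assoc x c M ⟨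
  (x + c) + M   ≤⟨ +-monoˡ-≤ M x+c≤K+y ⟩
  (K + y) + M   ≡⟨ +-assoc K y M ⟩
  K + (y + M)   ≡⟨ +-comm K (y + M) ⟩
  (y + M) + K   ∎)
  where open ≤-Reasoning

-- Iterating a map on Fin n

module FunctionalGraph {n} (p : Fin n → Fin n) where

  p^ : ℕ → Fin n → Fin n
  p^ t v = fold v p t

  p^-+ : ∀ s t v → p^ (s + t) v ≡ p^ s (p^ t v)
  p^-+ s t v = fold-+ v p s

  p^-suc : ∀ t v → p^ t (p v) ≡ p^ (suc t) v
  p^-suc t v = trans (sym (p^-+ t 1 v)) (cong (λ s → p^ s v) (+-comm t 1))

  p^-∸ : ∀ {s t} v → t ≤ s → p^ (s ∸ t) (p^ t v) ≡ p^ s v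
  p^-∸ {s} {t} v t≤s = trans (sym (p^-+ (s ∸ t) t v)) (cong (λ r → p^ r v) (m∸n+n≡m t≤s))

  Hits : Subset n → ℕ → Pred (Fin n) _
  Hits Q b v = ∃ λ t → t ≤ b × p^ t v ∈ Q

  hits? : ∀ Q b → Decidable (Hits Q b)
  hits? Q b v = map′ (λ { (t , t<b+1 , pᵗ∈Q) → t , ≤-pred t<b+1 , pᵗ∈Q })
                     (λ { (t , t≤b , pᵗ∈Q) → t , s≤s t≤b , pᵗ∈Q })
                     (anyUpTo? (λ t → p^ t v ∈? Q) (suc b))

  Hits-mono : ∀ {Q Q' b} → Q ⊆ Q' → ∀ {v} → Hits Q b v → Hits Q' b v
  Hits-mono Q⊆Q' (t , t≤b , pᵗ∈Q) = t , t≤b , Q⊆Q' pᵗ∈Q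

  IsCycle : Fin n → ℕ → Set
  IsCycle v ℓ = InjectiveUpTo (λ i → p^ i v) ℓ × p^ (suc ℓ) v ≡ v

  Periodic : Pred (Fin n) _
  Periodic v = ∃ λ c → 0 < c × p^ c v ≡ v

  p-periodic : ∀ {v} → Periodic v → Periodic (p v)
  p-periodic {v} (c , 0<c , period) = c , 0<c , trans (p^-suc c v) (cong p period)

  periodic-return : ∀ {v} → Periodic v → ∃ λ c → p (p^ c v) ≡ v
  periodic-return (suc c , _ , period) = c , period

  eventually-periodic : ∀ v → ∃ λ t → Periodic (p^ t v)
  eventually-periodic v with pigeonhole (n<1+n n) (λ (i : Fin (suc n)) → p^ (toℕ i) v)
  ... | i , j , i<j , pⁱ≡pʲ =
    toℕ i , toℕ j ∸ toℕ i , m<n⇒0<n∸m i<j , trans (p^-∸ v (<⇒≤ i<j)) (sym pⁱ≡pʲ)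

  p^-shortcut : ∀ {v i j} m → j ≤ m → p^ i v ≡ p^ j v → p^ (m ∸ j + i) v ≡ p^ m v
  p^-shortcut {v} {i} {j} m j≤m pⁱ≡pʲ =
    trans (p^-+ (m ∸ j) i v) (trans (cong (p^ (m ∸ j)) pⁱ≡pʲ) (p^-∸ v j≤m))

  first-hit-injective : ∀ {v ρ m} → Least (λ t → p^ t v ≡ ρ) m → InjectiveUpTo (λ i → p^ i v) m
  first-hit-injective {m = m} (hit , below) {i} {j} i≤m j≤m pⁱ≡pʲ with <-cmp i j
  ... | tri≈ _ i≡j _ = i≡j
  ... | tri< i<j _ _ = contradiction (trans (p^-shortcut m j≤m pⁱ≡pʲ) hit) (below (m∸j+i<m i<j j≤m))
  ... | tri> _ _ j<i = contradiction (trans (p^-shortcut m i≤m (sym pⁱ≡pʲ)) hit) (below (m∸j+i<m j<i i≤m))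

  record Closed (W : Subset n) : Set where
    field
      forward  : ∀ {v} → v ∈ W → p v ∈ W
      backward : ∀ {v} → p v ∈ W → v ∈ W

  Closed-─ : ∀ {W S} → Closed W → Closed S → Closed (W ─ S)
  Closed-─ {W} {S} W-closed S-closed = record
    { forward  = λ v∈W─S →
        x∈p∧x∉q⇒x∈p─q (W.forward (p─q⊆p W S v∈W─S)) (x∈p─q⇒x∉q W S v∈W─S ∘ S.backward)
    ; backward = λ pv∈W─S →
        x∈p∧x∉q⇒x∈p─q (W.backward (p─q⊆p W S pv∈W─S)) (x∈p─q⇒x∉q W S pv∈W─S ∘ S.forward)
    }
    where
    module W = Closed W-closed
    module S = Closed S-closed

  p^-preserves : ∀ {W} → Closed W → ∀ t {v} → v ∈ W → p^ t v ∈ W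
  p^-preserves W-closed zero    v∈W = v∈W
  p^-preserves W-closed (suc t) v∈W = Closed.forward W-closed (p^-preserves W-closed t v∈W)

  p^-reflects : ∀ {W} → Closed W → ∀ t {v} → p^ t v ∈ W → v ∈ W
  p^-reflects W-closed zero    v∈W  = v∈W
  p^-reflects W-closed (suc t) pv∈W = p^-reflects W-closed t (Closed.backward W-closed pv∈W)

  module Rooted (ρ : Fin n) (ρ-periodic : Periodic ρ) where

    -- Off the tree of ρ, depth v is the junk value n.
    depth : Fin n → ℕ
    depth v = least (λ t → p^ t v ≟ ρ) n

    InTree : Pred (Fin n) _
    InTree v = p^ (depth v) v ≡ ρ

    inTree? : Decidable InTree
    inTree? v = p^ (depth v) v ≟ ρ

    tree : Subset n
    tree = ⟦ inTree? ⟧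

    -- The first hit of ρ is reached through distinct vertices, hence before step n.
    reaches⇒Least : ∀ {v} t → p^ t v ≡ ρ → Least (λ s → p^ s v ≡ ρ) (depth v)
    reaches⇒Least {v} t pᵗ≡ρ = least-Least (λ s → p^ s v ≟ ρ) shortest<n (proj₁ shortest)
      where
      shortest = least-Least (λ s → p^ s v ≟ ρ) (n<1+n t) pᵗ≡ρ
      shortest<n : least (λ s → p^ s v ≟ ρ) (suc t) < n
      shortest<n = ≤-trans
        (injective⇒≤∣p∣ (λ i → p^ i v) _ (first-hit-injective shortest) (λ _ → ∈⊤))
        (≤-reflexive (∣⊤∣≡n n))

    reaches⇒InTree : ∀ {v} t → p^ t v ≡ ρ → InTree v
    reaches⇒InTree t pᵗ≡ρ = proj₁ (reaches⇒Least t pᵗ≡ρ)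

    reaches⇒depth≤ : ∀ {v} t → p^ t v ≡ ρ → depth v ≤ t
    reaches⇒depth≤ t pᵗ≡ρ = Least⇒≤ (reaches⇒Least t pᵗ≡ρ) pᵗ≡ρ

    depth-injective : ∀ {v} → InTree v → InjectiveUpTo (λ i → p^ i v) (depth v)
    depth-injective {v} v∈T = first-hit-injective (reaches⇒Least (depth v) v∈T)

    depth≡0⇒≡ρ : ∀ {v} → InTree v → depth v ≡ 0 → v ≡ ρ
    depth≡0⇒≡ρ {v} v∈T depth≡0 = subst (λ t → p^ t v ≡ ρ) depth≡0 v∈T

    InTree-ρ : InTree ρ
    InTree-ρ = reaches⇒InTree 0 refl

    InTree-p^ : ∀ {v} → InTree v → ∀ {t} → t ≤ depth v → InTree (p^ t v)
    InTree-p^ {v} v∈T {t} t≤d = reaches⇒InTree (depth v ∸ t) (trans (p^-∸ v t≤d) v∈T)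

    depth-p^ : ∀ {v} → InTree v → ∀ {t} → t ≤ depth v → depth (p^ t v) + t ≡ depth v
    depth-p^ {v} v∈T {t} t≤d = ≤-antisym upper lower
      where
      upper : depth (p^ t v) + t ≤ depth v
      upper = ≤-trans (+-monoˡ-≤ t (reaches⇒depth≤ (depth v ∸ t) (trans (p^-∸ v t≤d) v∈T)))
                      (≤-reflexive (m∸n+n≡m t≤d))
      lower : depth v ≤ depth (p^ t v) + t
      lower = reaches⇒depth≤ (depth (p^ t v) + t)
                (trans (p^-+ (depth (p^ t v)) t v) (InTree-p^ v∈T t≤d))

    predecessor : ∃ λ x → p x ≡ ρ
    predecessor = let c , return = periodic-return ρ-periodic in p^ c ρ , return

    InTree-pρ : InTree (p ρ)
    InTree-pρ = let c , return = periodic-return ρ-periodic in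
      reaches⇒InTree c (trans (p^-suc c ρ) return)

    cycle-through-root : IsCycle (p ρ) (depth (p ρ))
    cycle-through-root = depth-injective InTree-pρ , cong p InTree-pρ

    InTree-p⁻ : ∀ {v} → InTree (p v) → InTree v
    InTree-p⁻ {v} pv∈T =
      reaches⇒InTree (suc (depth (p v))) (trans (sym (p^-suc (depth (p v)) v)) pv∈T)

    InTree-p : ∀ {v} → InTree v → InTree (p v)
    InTree-p {v} v∈T with 0 <? depth v
    ... | yes 0<d = InTree-p^ v∈T 0<d
    ... | no  0≮d =
      subst (InTree ∘ p) (sym (depth≡0⇒≡ρ v∈T (n≤0⇒n≡0 (≮⇒≥ 0≮d)))) InTree-pρ

    tree-closed : Closed tree
    tree-closed = record
      { forward  = ∈⟦⟧⁺ inTree? ∘ InTree-p ∘ ∈⟦⟧⁻ inTree?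
      ; backward = ∈⟦⟧⁺ inTree? ∘ InTree-p⁻ ∘ ∈⟦⟧⁻ inTree?
      }

  -- Covering by a subset of one side

  module Kernel (U : Subset n) (alternates : ∀ v → (p v ∈ U × v ∉ U) ⊎ (p v ∉ U × v ∈ U))
    (k : ℕ) (1≤k : 1 ≤ k) (long-cycles : ∀ v ℓ → IsCycle v ℓ → k + 2 ≤ suc ℓ) where

    q K : ℕ
    q = suc (2 * k)
    K = k + 2

    K≤q : K ≤ q
    K≤q = begin
      k + 2         ≤⟨ +-monoʳ-≤ k (s≤s 1≤k) ⟩
      k + suc k     ≡⟨ +-suc k k ⟩
      suc (k + k)   ≡⟨ cong (λ m → suc (k + m)) (sym (+-identityʳ k)) ⟩
      q             ∎
      where open ≤-Reasoning

    K+K≡q+3 : K + K ≡ q + 3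
    K+K≡q+3 = trans (cong (K +_) (sym (+-identityʳ K))) (2*[k+2]≡[1+2k]+3 k)

    -- The step that kills p ρ kills c vertices: at least q on the path from v, and the t + 1 from
    -- p ρ up to the new vertex. A vertex at depth d that it leaves uncovered has q < t + 1 + d,
    -- and t ≠ 2k by parity.
    cut-pays : ∀ {t d c} → q ≤ c → suc t ≤ c → q < t + suc d → t ≢ 2 * k → 0 < d →
               K + K ≤ c + suc d
    cut-pays {t} {d} {c} q≤c t<c far t≢2k 0<d with <-cmp t (2 * k)
    ... | tri≈ _ t≡2k _ = contradiction t≡2k t≢2k
    ... | tri< t<2k _ _ = begin
      K + K       ≡⟨ K+K≡q+3 ⟩
      q + 3       ≤⟨ +-mono-≤ q≤c (+-cancelˡ-≤ t 3 (suc d) t+3≤t+suc[d]) ⟩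
      c + suc d   ∎
      where
      open ≤-Reasoning
      t+3≤t+suc[d] : t + 3 ≤ t + suc d
      t+3≤t+suc[d] = begin
        t + 3       ≡⟨ +-comm t 3 ⟩
        3 + t       ≤⟨ s≤s (s≤s t<2k) ⟩
        suc q       ≤⟨ far ⟩
        t + suc d   ∎
    ... | tri> _ _ 2k<t = begin
      K + K       ≡⟨ K+K≡q+3 ⟩
      q + 3       ≡⟨ cong suc (+-suc (2 * k) 2) ⟩
      suc q + 2   ≤⟨ +-mono-≤ (≤-trans (s≤s 2k<t) t<c) (s≤s 0<d) ⟩
      c + suc d   ∎
      where open ≤-Reasoning

    ∈U⇒p∉U : ∀ {v} → v ∈ U → p v ∉ U
    ∈U⇒p∉U {v} v∈U with alternates v
    ... | inj₁ (_ , v∉U)  = contradiction v∈U v∉U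
    ... | inj₂ (pv∉U , _) = pv∉U

    ∉U⇒p∈U : ∀ {v} → v ∉ U → p v ∈ U
    ∉U⇒p∈U {v} v∉U with alternates v
    ... | inj₁ (pv∈U , _) = pv∈U
    ... | inj₂ (_ , v∈U)  = contradiction v∈U v∉U

    p∈U⇒∉U : ∀ {v} → p v ∈ U → v ∉ U
    p∈U⇒∉U pv∈U v∈U = ∈U⇒p∉U v∈U pv∈U

    ∉U⇒p²ʲ∉U : ∀ j {v} → v ∉ U → p^ (2 * j) v ∉ U
    ∉U⇒p²ʲ∉U zero    v∉U = v∉U
    ∉U⇒p²ʲ∉U (suc j) {v} v∉U =
      subst (λ t → p^ t v ∉ U) (sym (*-suc 2 j)) (∈U⇒p∉U (∉U⇒p∈U (∉U⇒p²ʲ∉U j v∉U)))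

    U-within-q : ∀ v → ∃ λ r → 2 * k ≤ r × r ≤ q × p^ r v ∈ U
    U-within-q v with p^ (2 * k) v ∈? U
    ... | yes p²ᵏ∈U = 2 * k , ≤-refl , n≤1+n _ , p²ᵏ∈U
    ... | no  p²ᵏ∉U = q , n≤1+n _ , ≤-refl , ∉U⇒p∈U p²ᵏ∉U

    periodic-in-U : ∀ v → ∃₂ λ t ρ → p^ t v ≡ ρ × ρ ∈ U × Periodic ρ
    periodic-in-U v with eventually-periodic v
    ... | t , periodic with p^ t v ∈? U
    ...   | yes pᵗ∈U = t , _ , refl , pᵗ∈U , periodic
    ...   | no  pᵗ∉U = suc t , _ , refl , ∉U⇒p∈U pᵗ∉U , p-periodic periodic

    Covered : Subset n → Pred (Fin n) _
    Covered Q = Hits Q q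

    record SmallCover (W : Subset n) : Set where
      field
        cover   : Subset n
        cover⊆U : cover ⊆ U
        covers  : ∀ {w} → w ∈ W → Covered cover w
        small   : K * ∣ cover ∣ ≤ ∣ W ∣

    K*∣∅∣≡0 : K * ∣ ∅ {n = n} ∣ ≡ 0
    K*∣∅∣≡0 = trans (cong (K *_) (∣⊥∣≡0 n)) (*-zeroʳ K)

    K*∣Q∪⁅x⁆∣≤K+K*∣Q∣ : ∀ (Q : Subset n) x → K * ∣ Q ∪ ⁅ x ⁆ ∣ ≤ K + K * ∣ Q ∣
    K*∣Q∪⁅x⁆∣≤K+K*∣Q∣ Q x =
      ≤-trans (*-monoʳ-≤ K (∣p∪⁅x⁆∣≤1+∣p∣ Q x)) (≤-reflexive (*-suc K ∣ Q ∣))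

    module Greedy (ρ : Fin n) (ρ∈U : ρ ∈ U) (ρ-periodic : Periodic ρ) where
      open Rooted ρ ρ-periodic

      Alive : Subset n → Pred (Fin n) _
      Alive Q w = InTree w × ¬ Hits Q (depth w) w

      alive? : ∀ Q → Decidable (Alive Q)
      alive? Q w = inTree? w ×-dec ¬? (hits? Q (depth w) w)

      alive : Subset n → Subset n
      alive Q = ⟦ alive? Q ⟧

      -- Φ Q ≤ ∣ tree ∣ says that every vertex of Q was paid for by K vertices that are no longer alive.
      Φ : Subset n → ℕ
      Φ Q = K * ∣ Q ∣ + ∣ alive Q ∣

      Alive-anti : ∀ {Q Q'} → Q ⊆ Q' → ∀ {w} → Alive Q' w → Alive Q w
      Alive-anti Q⊆Q' (w∈T , no-hit) = w∈T , no-hit ∘ Hits-mono Q⊆Q'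

      alive-anti : ∀ {Q Q'} → Q ⊆ Q' → alive Q' ⊆ alive Q
      alive-anti {Q} {Q'} Q⊆Q' = ∈⟦⟧⁺ (alive? Q) ∘ Alive-anti Q⊆Q' ∘ ∈⟦⟧⁻ (alive? Q')

      alive⊆tree : ∀ Q → alive Q ⊆ tree
      alive⊆tree Q = ∈⟦⟧⁺ inTree? ∘ proj₁ ∘ ∈⟦⟧⁻ (alive? Q)

      Hits-p^ : ∀ {Q w} → InTree w → ∀ {t} → t ≤ depth w →
                Hits Q (depth (p^ t w)) (p^ t w) → Hits Q (depth w) w
      Hits-p^ {Q} {w} w∈T {t} t≤d (s , s≤d , pˢ∈Q) =
        s + t , ≤-trans (+-monoˡ-≤ t s≤d) (≤-reflexive (depth-p^ w∈T t≤d)) ,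
        subst (_∈ Q) (sym (p^-+ s t w)) pˢ∈Q

      Alive-p^ : ∀ {Q w} → Alive Q w → ∀ {t} → t ≤ depth w → Alive Q (p^ t w)
      Alive-p^ (w∈T , no-hit) t≤d = InTree-p^ w∈T t≤d , no-hit ∘ Hits-p^ w∈T t≤d

      ¬Alive⇒Hits : ∀ {Q w} → InTree w → ¬ Alive Q w → Hits Q (depth w) w
      ¬Alive⇒Hits {Q} {w} w∈T dead =
        decidable-stable (hits? Q (depth w) w) (λ no-hit → dead (w∈T , no-hit))

      Alive⇒≤∣alive∣ : ∀ {Q w} → Alive Q w → suc (depth w) ≤ ∣ alive Q ∣
      Alive⇒≤∣alive∣ {Q} {w} w-alive = injective⇒≤∣p∣ (λ i → p^ i w) (depth w)
        (depth-injective (proj₁ w-alive)) (∈⟦⟧⁺ (alive? Q) ∘ Alive-p^ w-alive)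

      killed : ∀ {Q Q' w s} → Alive Q w → s ≤ depth w → p^ s w ∈ Q' →
        ∀ {j} → j ≤ s → p^ j w ∈ alive Q ─ alive Q'
      killed {Q} {Q'} {w} {s} w-alive s≤d pˢ∈Q' {j} j≤s =
        x∈p∧x∉q⇒x∈p─q (∈⟦⟧⁺ (alive? Q) (Alive-p^ w-alive j≤d))
                      (λ pʲ∈A' → proj₂ (∈⟦⟧⁻ (alive? Q') pʲ∈A') (s ∸ j , s∸j≤ , pˢ⁻ʲ∈Q'))
        where
        j≤d : j ≤ depth w
        j≤d = ≤-trans j≤s s≤d
        s∸j≤ : s ∸ j ≤ depth (p^ j w)
        s∸j≤ = ≤-trans (∸-monoˡ-≤ j s≤d)
          (≤-reflexive (trans (cong (_∸ j) (sym (depth-p^ (proj₁ w-alive) j≤d))) (m+n∸n≡m _ j)))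
        pˢ⁻ʲ∈Q' : p^ (s ∸ j) (p^ j w) ∈ Q'
        pˢ⁻ʲ∈Q' = subst (_∈ Q') (sym (p^-∸ w j≤s)) pˢ∈Q'

      killed-count : ∀ {Q Q' w s} → Alive Q w → s ≤ depth w → p^ s w ∈ Q' →
                     suc s ≤ ∣ alive Q ─ alive Q' ∣
      killed-count {w = w} {s} w-alive s≤d pˢ∈Q' = injective⇒≤∣p∣ (λ j → p^ j w) s
        (λ i≤s j≤s → depth-injective (proj₁ w-alive) (≤-trans i≤s s≤d) (≤-trans j≤s s≤d))
        (killed w-alive s≤d pˢ∈Q')

      alive-split : ∀ {Q Q'} → Q ⊆ Q' → ∣ alive Q ∣ ≡ ∣ alive Q' ∣ + ∣ alive Q ─ alive Q' ∣
      alive-split Q⊆Q' = q⊆p⇒∣p∣≡∣q∣+∣p─q∣ (alive-anti Q⊆Q')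

      Φ-add : ∀ Q a → Φ (Q ∪ ⁅ a ⁆) + ∣ alive Q ─ alive (Q ∪ ⁅ a ⁆) ∣ ≤ K + Φ Q
      Φ-add Q a = begin
        K * ∣ Q' ∣ + ∣ alive Q' ∣ + ∣ P ∣   ≡⟨ +-assoc (K * ∣ Q' ∣) _ _ ⟩
        K * ∣ Q' ∣ + (∣ alive Q' ∣ + ∣ P ∣) ≡⟨ cong (K * ∣ Q' ∣ +_) (alive-split (p⊆p∪q ⁅ a ⁆)) ⟨
        K * ∣ Q' ∣ + ∣ alive Q ∣            ≤⟨ +-monoˡ-≤ _ (K*∣Q∪⁅x⁆∣≤K+K*∣Q∣ Q a) ⟩
        K + K * ∣ Q ∣ + ∣ alive Q ∣         ≡⟨ +-assoc K _ _ ⟩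
        K + Φ Q                             ∎
        where
        open ≤-Reasoning
        Q' = Q ∪ ⁅ a ⁆
        P = alive Q ─ alive Q'

      K≤cycle : K ≤ suc (depth (p ρ))
      K≤cycle = long-cycles (p ρ) (depth (p ρ)) cycle-through-root

      record Invariant (Q : Subset n) : Set where
        field
          Q⊆U          : Q ⊆ U
          bounded      : Φ Q ≤ ∣ tree ∣
          dead-covered : ∀ {w} → InTree w → ¬ Alive Q w → Covered Q w
          -- The step that cut the cycle through ρ paid more than K; the surplus, together with the
          -- alive path from u to ρ, pays for adding ρ at the end.
          top          : ¬ Alive Q (p ρ) → ∀ {u} → Alive Q u → 0 < depth u → ¬ Covered Q u →
                         K + Φ Q ≤ ∣ tree ∣ + suc (depth u)

      start : Invariant ∅
      start = record
        { Q⊆U          = λ x∈∅ → contradiction x∈∅ ∉⊥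
        ; bounded      = begin
            Φ ∅                     ≡⟨ cong (_+ ∣ alive ∅ ∣) K*∣∅∣≡0 ⟩
            ∣ alive ∅ ∣             ≤⟨ p⊆q⇒∣p∣≤∣q∣ (alive⊆tree ∅) ⟩
            ∣ tree ∣                ∎
        ; dead-covered = λ w∈T dead → contradiction (all-alive w∈T) dead
        ; top          = λ pρ-dead → contradiction (all-alive InTree-pρ) pρ-dead
        }
        where
        open ≤-Reasoning
        all-alive : ∀ {w} → InTree w → Alive ∅ w
        all-alive w∈T = w∈T , λ (_ , _ , pᵗ∈∅) → ∉⊥ pᵗ∈∅

      module Step {Q} (inv : Invariant Q) {v} (v-alive : Alive Q v)
                  (deepest : ∀ {w} → Alive Q w → depth w ≤ depth v) (q≤depth : q ≤ depth v)
                  {r} (2k≤r : 2 * k ≤ r) (r≤q : r ≤ q) (a∈U : p^ r v ∈ U) where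
        open Invariant inv

        a : Fin n
        a = p^ r v

        Q' : Subset n
        Q' = Q ∪ ⁅ a ⁆

        P : Subset n
        P = alive Q ─ alive Q'

        r≤depth : r ≤ depth v
        r≤depth = ≤-trans r≤q q≤depth

        a∈Q' : a ∈ Q'
        a∈Q' = x∈p∪q⁺ (inj₂ (x∈⁅x⁆ a))

        q≤∣P∣ : q ≤ ∣ P ∣
        q≤∣P∣ = ≤-trans (s≤s 2k≤r) (killed-count v-alive r≤depth a∈Q')

        hits-a : ∀ {w} → Alive Q w → ¬ Alive Q' w → ∃ λ t → t ≤ depth w × p^ t w ≡ a
        hits-a (w∈T , no-hit) dead with ¬Alive⇒Hits w∈T dead
        ... | t , t≤d , pᵗ∈Q' with x∈p∪q⁻ Q ⁅ a ⁆ pᵗ∈Q'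
        ...   | inj₁ pᵗ∈Q = contradiction (t , t≤d , pᵗ∈Q) no-hit
        ...   | inj₂ pᵗ≡a = t , t≤d , x∈⁅y⁆⇒x≡y a pᵗ≡a

        Φ-decreases : Φ Q' ≤ Φ Q
        Φ-decreases = charge-absorbed (Φ-add Q a) (≤-trans K≤q q≤∣P∣)

        dead-covered' : ∀ {w} → InTree w → ¬ Alive Q' w → Covered Q' w
        dead-covered' {w} w∈T dead' with alive? Q w
        ... | no  dead    = Hits-mono (p⊆p∪q ⁅ a ⁆) (dead-covered w∈T dead)
        ... | yes w-alive with hits-a w-alive dead'
        ...   | t , t≤d , pᵗ≡a = t , ≤-trans t≤r r≤q , subst (_∈ Q') (sym pᵗ≡a) a∈Q'
          where
          -- v is a deepest alive vertex, so it is at least as far from a as w is.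
          t≤r : t ≤ r
          t≤r = +-cancelˡ-≤ (depth a) t r (begin
            depth a + t          ≡⟨ cong (λ x → depth x + t) pᵗ≡a ⟨
            depth (p^ t w) + t   ≡⟨ depth-p^ w∈T t≤d ⟩
            depth w              ≤⟨ deepest w-alive ⟩
            depth v              ≡⟨ depth-p^ (proj₁ v-alive) r≤depth ⟨
            depth a + r          ∎)
            where open ≤-Reasoning

        cut-cycle : Alive Q (p ρ) → ¬ Alive Q' (p ρ) →
                    ∀ {u} → Alive Q' u → 0 < depth u → ¬ Covered Q' u → K + Φ Q' ≤ ∣ tree ∣ + suc (depth u)
        cut-cycle pρ-alive pρ-dead' {u} u-alive' 0<d uncovered' with hits-a pρ-alive pρ-dead'
        ... | t , t≤d , pᵗ≡a =
          ≤-trans (charge-doubled {K = K} (Φ-add Q a) (cut-pays q≤∣P∣ t<∣P∣ far t≢2k 0<d))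
                  (+-monoˡ-≤ _ bounded)
          where
          t<∣P∣ : suc t ≤ ∣ P ∣
          t<∣P∣ = killed-count pρ-alive t≤d (subst (_∈ Q') (sym pᵗ≡a) a∈Q')
          u-reaches-a : p^ (t + suc (depth u)) u ≡ a
          u-reaches-a = begin
            p^ (t + suc (depth u)) u  ≡⟨ p^-+ t (suc (depth u)) u ⟩
            p^ t (p (p^ (depth u) u)) ≡⟨ cong (p^ t ∘ p) (proj₁ u-alive') ⟩
            p^ t (p ρ)                ≡⟨ pᵗ≡a ⟩
            a                         ∎
            where open ≡-Reasoning
          far : q < t + suc (depth u)
          far = ≰⇒> λ within →
            uncovered' (t + suc (depth u) , within , subst (_∈ Q') (sym u-reaches-a) a∈Q')
          t≢2k : t ≢ 2 * k
          t≢2k t≡2k = ∉U⇒p²ʲ∉U k (∈U⇒p∉U ρ∈U)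
            (subst (_∈ U) (trans (sym pᵗ≡a) (cong (λ s → p^ s (p ρ)) t≡2k)) a∈U)

        top' : ¬ Alive Q' (p ρ) → ∀ {u} → Alive Q' u → 0 < depth u → ¬ Covered Q' u →
               K + Φ Q' ≤ ∣ tree ∣ + suc (depth u)
        top' pρ-dead' u-alive' 0<d uncovered' with alive? Q (p ρ)
        ... | yes pρ-alive = cut-cycle pρ-alive pρ-dead' u-alive' 0<d uncovered'
        ... | no  pρ-dead  = ≤-trans (+-monoʳ-≤ K Φ-decreases)
          (top pρ-dead (Alive-anti (p⊆p∪q ⁅ a ⁆) u-alive') 0<d (uncovered' ∘ Hits-mono (p⊆p∪q ⁅ a ⁆)))

        invariant : Invariant Q'
        invariant = record
          { Q⊆U          = p⊆r∧q⊆r⇒p∪q⊆r Q⊆U (x∈p⇒⁅x⁆⊆p a∈U)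
          ; bounded      = ≤-trans Φ-decreases bounded
          ; dead-covered = dead-covered'
          ; top          = top'
          }

        shrinks : ∣ alive Q' ∣ < ∣ alive Q ∣
        shrinks = begin-strict
          ∣ alive Q' ∣            <⟨ m<m+n ∣ alive Q' ∣ (≤-trans (s≤s z≤n) q≤∣P∣) ⟩
          ∣ alive Q' ∣ + ∣ P ∣    ≡⟨ alive-split (p⊆p∪q ⁅ a ⁆) ⟨
          ∣ alive Q ∣             ∎
          where open ≤-Reasoning

      module Finish {Q} (inv : Invariant Q) (shallow : ∀ {w} → Alive Q w → depth w ≤ 2 * k) where
        open Invariant inv

        UncoveredBelowRoot : Set
        UncoveredBelowRoot = ∃ λ u → Alive Q u × 0 < depth u × ¬ Covered Q u

        uncovered-predecessor : Alive Q ρ → ¬ Covered Q ρ → UncoveredBelowRoot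
        uncovered-predecessor (_ , ρ-no-hit) ρ-uncovered = x , (x∈T , x-no-hit) , 0<depth , x-uncovered
          where
          x = proj₁ predecessor
          px≡ρ = proj₂ predecessor
          x∉U : x ∉ U
          x∉U = p∈U⇒∉U (subst (_∈ U) (sym px≡ρ) ρ∈U)
          x∈T : InTree x
          x∈T = reaches⇒InTree 1 px≡ρ
          0<depth : 0 < depth x
          0<depth = n≢0⇒n>0 λ depth≡0 → x∉U (subst (_∈ U) (sym (depth≡0⇒≡ρ x∈T depth≡0)) ρ∈U)
          x-no-hit : ¬ Hits Q (depth x) x
          x-no-hit (zero        , _   , x∈Q)  = x∉U (Q⊆U x∈Q)
          x-no-hit (suc zero    , _   , px∈Q) = ρ-no-hit (0 , z≤n , subst (_∈ Q) px≡ρ px∈Q)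
          x-no-hit (suc (suc _) , t≤d , _)    =
            contradiction (≤-trans t≤d (reaches⇒depth≤ 1 px≡ρ)) λ { (s≤s ()) }
          x-uncovered : ¬ Covered Q x
          x-uncovered (zero  , _     , x∈Q)    = x∉U (Q⊆U x∈Q)
          x-uncovered (suc t , t+1≤q , pᵗ⁺¹∈Q) = ρ-uncovered
            (t , ≤-trans (n≤1+n t) t+1≤q ,
             subst (_∈ Q) (trans (sym (p^-suc t x)) (cong (p^ t) px≡ρ)) pᵗ⁺¹∈Q)

        uncovered-below-root : ∀ {u} → Alive Q u → ¬ Covered Q u → UncoveredBelowRoot
        uncovered-below-root {u} u-alive u-uncovered with 0 <? depth u
        ... | yes 0<d = u , u-alive , 0<d , u-uncovered
        ... | no  0≮d =
          uncovered-predecessor (subst (Alive Q) u≡ρ u-alive) (subst (¬_ ∘ Covered Q) u≡ρ u-uncovered)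
          where
          u≡ρ : u ≡ ρ
          u≡ρ = depth≡0⇒≡ρ (proj₁ u-alive) (n≤0⇒n≡0 (≮⇒≥ 0≮d))

        root-affordable : ∀ {u} → Alive Q u → ¬ Covered Q u → K + K * ∣ Q ∣ ≤ ∣ tree ∣
        root-affordable u-alive u-uncovered with alive? Q (p ρ)
        ... | yes pρ-alive = begin
          K + K * ∣ Q ∣            ≤⟨ +-monoˡ-≤ _ (≤-trans K≤cycle (Alive⇒≤∣alive∣ pρ-alive)) ⟩
          ∣ alive Q ∣ + K * ∣ Q ∣  ≡⟨ +-comm _ (K * ∣ Q ∣) ⟩
          Φ Q                      ≤⟨ bounded ⟩
          ∣ tree ∣                 ∎
          where open ≤-Reasoning
        ... | no  pρ-dead with uncovered-below-root u-alive u-uncovered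
        ...   | u' , u'-alive , 0<d , u'-uncovered = +-cancelʳ-≤ (suc (depth u')) _ _ (begin
          K + K * ∣ Q ∣ + suc (depth u') ≤⟨ +-monoʳ-≤ (K + K * ∣ Q ∣) (Alive⇒≤∣alive∣ u'-alive) ⟩
          K + K * ∣ Q ∣ + ∣ alive Q ∣     ≡⟨ +-assoc K _ _ ⟩
          K + Φ Q                        ≤⟨ top pρ-dead u'-alive 0<d u'-uncovered ⟩
          ∣ tree ∣ + suc (depth u')      ∎)
          where open ≤-Reasoning

        add-root : ∀ {u} → Alive Q u → ¬ Covered Q u → SmallCover tree
        add-root u-alive u-uncovered = record
          { cover   = Q ∪ ⁅ ρ ⁆
          ; cover⊆U = p⊆r∧q⊆r⇒p∪q⊆r Q⊆U (x∈p⇒⁅x⁆⊆p ρ∈U)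
          ; covers  = covers
          ; small   = ≤-trans (K*∣Q∪⁅x⁆∣≤K+K*∣Q∣ Q ρ) (root-affordable u-alive u-uncovered)
          }
          where
          covers : ∀ {w} → w ∈ tree → Covered (Q ∪ ⁅ ρ ⁆) w
          covers {w} w∈tree with alive? Q w
          ... | yes w-alive = depth w , ≤-trans (shallow w-alive) (n≤1+n _) ,
                              subst (_∈ Q ∪ ⁅ ρ ⁆) (sym (proj₁ w-alive)) (x∈p∪q⁺ (inj₂ (x∈⁅x⁆ ρ)))
          ... | no  dead    = Hits-mono (p⊆p∪q ⁅ ρ ⁆) (dead-covered (∈⟦⟧⁻ inTree? w∈tree) dead)

        all-alive-covered : (∀ {u} → Alive Q u → Covered Q u) → SmallCover tree
        all-alive-covered alive-covered = record
          { cover = Q ; cover⊆U = Q⊆U ; covers = covers ; small = ≤-trans (m≤m+n _ _) bounded }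
          where
          covers : ∀ {w} → w ∈ tree → Covered Q w
          covers {w} w∈tree with alive? Q w
          ... | yes w-alive = alive-covered w-alive
          ... | no  dead    = dead-covered (∈⟦⟧⁻ inTree? w∈tree) dead

        result : SmallCover tree
        result with any? (λ u → alive? Q u ×-dec ¬? (hits? Q q u))
        ... | yes (u , u-alive , u-uncovered) = add-root u-alive u-uncovered
        ... | no  none = all-alive-covered λ {u} u-alive →
          decidable-stable (hits? Q q u) (λ u-uncovered → none (u , u-alive , u-uncovered))

      grow : ∀ {Q} → Invariant Q → Acc _<_ ∣ alive Q ∣ → SmallCover tree
      grow {Q} inv (acc smaller) with any? (λ w → alive? Q w ×-dec (q ≤? depth w))
      ... | no  none = Finish.result inv λ {w} w-alive → ≤-pred (≰⇒> (λ q≤d → none (w , w-alive , q≤d)))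
      ... | yes (w , w-alive , q≤d) with maximiser (alive? Q) depth (w , w-alive)
      ...   | v , v-alive , deepest with U-within-q v
      ...     | r , 2k≤r , r≤q , a∈U = grow S.invariant (smaller S.shrinks)
        where module S = Step inv v-alive deepest (≤-trans q≤d (deepest w-alive)) 2k≤r r≤q a∈U

      tree-cover : SmallCover tree
      tree-cover = grow start (<-wellFounded _)

    SmallCover-empty : ∀ {W} → ¬ Nonempty W → SmallCover W
    SmallCover-empty {W} empty = record
      { cover   = ∅
      ; cover⊆U = λ x∈∅ → contradiction x∈∅ ∉⊥
      ; covers  = λ {w} w∈W → contradiction (w , w∈W) empty
      ; small   = ≤-trans (≤-reflexive K*∣∅∣≡0) z≤n
      }

    SmallCover-split : ∀ {W S} → S ⊆ W → SmallCover S → SmallCover (W ─ S) → SmallCover W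
    SmallCover-split {W} {S} S⊆W on-S off-S = record
      { cover   = I.cover ∪ O.cover
      ; cover⊆U = p⊆r∧q⊆r⇒p∪q⊆r I.cover⊆U O.cover⊆U
      ; covers  = covers
      ; small   = begin
          K * ∣ I.cover ∪ O.cover ∣           ≤⟨ *-monoʳ-≤ K (∣p∪q∣≤∣p∣+∣q∣ I.cover O.cover) ⟩
          K * (∣ I.cover ∣ + ∣ O.cover ∣)      ≡⟨ *-distribˡ-+ K ∣ I.cover ∣ ∣ O.cover ∣ ⟩
          K * ∣ I.cover ∣ + K * ∣ O.cover ∣    ≤⟨ +-mono-≤ I.small O.small ⟩
          ∣ S ∣ + ∣ W ─ S ∣                   ≡⟨ q⊆p⇒∣p∣≡∣q∣+∣p─q∣ S⊆W ⟨
          ∣ W ∣                               ∎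
      }
      where
      open ≤-Reasoning
      module I = SmallCover on-S
      module O = SmallCover off-S
      covers : ∀ {w} → w ∈ W → Covered (I.cover ∪ O.cover) w
      covers {w} w∈W with w ∈? S
      ... | yes w∈S = Hits-mono (p⊆p∪q O.cover) (I.covers w∈S)
      ... | no  w∉S = Hits-mono (q⊆p∪q I.cover O.cover) (O.covers (x∈p∧x∉q⇒x∈p─q w∈W w∉S))

    cover-closed : ∀ {W} → Closed W → Acc _<_ ∣ W ∣ → SmallCover W
    cover-closed {W} W-closed (acc smaller) with nonempty? W
    ... | no  empty    = SmallCover-empty empty
    ... | yes (w , w∈W) with periodic-in-U w
    ...   | t , ρ , pᵗ≡ρ , ρ∈U , ρ-periodic = SmallCover-split tree⊆W (Greedy.tree-cover ρ ρ∈U ρ-periodic) rest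
      where
      open Rooted ρ ρ-periodic
      ρ∈W : ρ ∈ W
      ρ∈W = subst (_∈ W) pᵗ≡ρ (p^-preserves W-closed t w∈W)
      ρ∈tree : ρ ∈ tree
      ρ∈tree = ∈⟦⟧⁺ inTree? InTree-ρ
      tree⊆W : tree ⊆ W
      tree⊆W {v} v∈tree = p^-reflects W-closed (depth v) (subst (_∈ W) (sym (∈⟦⟧⁻ inTree? v∈tree)) ρ∈W)
      rest : SmallCover (W ─ tree)
      rest = cover-closed (Closed-─ W-closed tree-closed)
                          (smaller (p∩q≢∅⇒∣p─q∣<∣p∣ W tree (ρ , x∈p∩q⁺ (ρ∈W , ρ∈tree))))

    kernel : ∃ λ Q → Q ⊆ U × (∀ v → Covered Q v) × K * ∣ Q ∣ ≤ n
    kernel = cover , cover⊆U , (λ v → covers ∈⊤) , ≤-trans small (≤-reflexive (∣⊤∣≡n n))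
      where
      ⊤-closed : Closed ⊤
      ⊤-closed = record { forward = λ _ → ∈⊤ ; backward = λ _ → ∈⊤ }
      open SmallCover (cover-closed ⊤-closed (<-wellFounded _))

-- In-neighbour maps of digraphs

⊆U⇒Independent : ∀ {D U Q} → IsBipartition D U → Q ⊆ U → Independent D Q
⊆U⇒Independent bipartition Q⊆U u v u∈Q v∈Q u→v with bipartition u v u→v
... | inj₁ (_ , v∉U) = v∉U (Q⊆U v∈Q)
... | inj₂ (u∉U , _) = u∉U (Q⊆U u∈Q)

module InNeighbours (D : Digraph) (source-free : SourceFree D) where

  in-neighbour : Vtx D → Vtx D
  in-neighbour v = proj₁ (source-free v)

  arc-in : ∀ v → Arc D (in-neighbour v) v
  arc-in v = proj₂ (source-free v)

  open FunctionalGraph in-neighbour public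

  walk-p^ : ∀ t v → Walk D (p^ t v) v t
  walk-p^ zero    v = []
  walk-p^ (suc t) v = arc-in (p^ t v) ∷ walk-p^ t v

  orbit : ∀ v m → Vec (Vtx D) (suc m)
  orbit v zero    = v ∷ []
  orbit v (suc m) = p^ (suc m) v ∷ orbit v m

  head-orbit : ∀ v m → head (orbit v m) ≡ p^ m v
  head-orbit v zero    = refl
  head-orbit v (suc m) = refl

  last-orbit : ∀ v m → last (orbit v m) ≡ v
  last-orbit v zero          = refl
  last-orbit v (suc zero)    = refl
  last-orbit v (suc (suc m)) = last-orbit v (suc m)

  orbit-all : ∀ {P : Pred (Vtx D) ℓ} v m → (∀ {i} → i ≤ m → P (p^ i v)) → All P (orbit v m)
  orbit-all v zero    P-orbit = P-orbit z≤n ∷ []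
  orbit-all v (suc m) P-orbit = P-orbit ≤-refl ∷ orbit-all v m (P-orbit ∘ m≤n⇒m≤1+n)

  orbit-distinct : ∀ v m → InjectiveUpTo (λ i → p^ i v) m → AllPairs _≢_ (orbit v m)
  orbit-distinct v zero    _   = [] ∷ []
  orbit-distinct v (suc m) inj =
    orbit-all v m (λ i≤m → <⇒≢ (s≤s i≤m) ∘ sym ∘ inj ≤-refl (m≤n⇒m≤1+n i≤m)) ∷
    orbit-distinct v m (λ i≤m j≤m → inj (m≤n⇒m≤1+n i≤m) (m≤n⇒m≤1+n j≤m))

  orbit-linked : ∀ v m → Linked (Arc D) (orbit v m)
  orbit-linked v zero          = [-]
  orbit-linked v (suc zero)    = arc-in v ∷ [-]
  orbit-linked v (suc (suc m)) = arc-in (p^ (suc m) v) ∷ orbit-linked v (suc m)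

  orbit-cycle : ∀ {v m} → IsCycle v m → IsDirectedCycle D m (orbit v m)
  orbit-cycle {v} {m} (inj , return) = orbit-distinct v m inj , orbit-linked v m ,
    subst₂ (Arc D) (trans return (sym (last-orbit v m))) (sym (head-orbit v m)) (arc-in (p^ m v))

1≤k : ∀ {k} → 3 ≤ suc (2 * k) → 1 ≤ k
1≤k {zero}  (s≤s ())
1≤k {suc k} _ = s≤s z≤n

theorem6p5 : (D : Digraph) → (U : Subset (n D)) → SourceFree D → IsBipartition D U →
    (q : ℕ) → 3 ≤ q → (∃ λ (k : ℕ) → q ≡ suc (2 * k)) →
    (∀ (ℓ : ℕ) (xs : Vec (Vtx D) (suc ℓ)) → IsDirectedCycle D ℓ xs → q + 3 ≤ 2 * suc ℓ) →
    ∃ λ (Q : Subset (n D)) → IsQKernel D q Q × (q + 3) * ∣ Q ∣ ≤ 2 * n D × Q ⊆ U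
theorem6p5 D U source-free bipartition .(suc (2 * k)) 3≤q (k , refl) long-cycles =
  let Q , Q⊆U , covered , small = kernel in
  Q , (⊆U⇒Independent bipartition Q⊆U , λ v → within-q (covered v)) , scale small , Q⊆U
  where
  open InNeighbours D source-free
  alternates : ∀ v → (in-neighbour v ∈ U × v ∉ U) ⊎ (in-neighbour v ∉ U × v ∈ U)
  alternates v = bipartition (in-neighbour v) v (arc-in v)
  orbits-long : ∀ v m → IsCycle v m → k + 2 ≤ suc m
  orbits-long v m cycle = *-cancelˡ-≤ 2
    (subst (_≤ 2 * suc m) (sym (2*[k+2]≡[1+2k]+3 k)) (long-cycles m (orbit v m) (orbit-cycle cycle)))
  open Kernel U alternates k (1≤k 3≤q) orbits-long
  within-q : ∀ {Q v} → Covered Q v → DistLe D Q v q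
  within-q {v = v} (t , t≤q , pᵗ∈Q) = p^ t v , t , pᵗ∈Q , t≤q , walk-p^ t v
  scale : ∀ {c} → K * c ≤ n D → (q + 3) * c ≤ 2 * n D
  scale {c} Kc≤n = begin
    (q + 3) * c   ≡⟨ cong (_* c) (2*[k+2]≡[1+2k]+3 k) ⟨
    2 * K * c     ≡⟨ *-assoc 2 K c ⟩
    2 * (K * c)   ≤⟨ *-monoʳ-≤ 2 Kc≤n ⟩
    2 * n D       ∎
    where open ≤-Reasoning
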